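{- For all integers $j\ge0$, $L(j,0)=1$, and for all integers $1\le t\le j$, \[ L(j,t)=\sum_{i=1}^t\lambda_iL(j-i,t-i)+\sum_{i=t+1}^j\lambda_i. \]
   Context: Fix nonnegative integers $\lambda_1,\lambda_2,\dots$ and an integer $k\ge1$ (the order) such that $\lambda_1\ge1$, $\lambda_k\ge1$, $\lambda_i=0$ for $i>k$, and $\lambda_1\ge2$ if $k=1$. Let $\Lambda_j=\sum_{i=1}^j\lambda_i$. Finite ordered trees $T_j$: $T_0$ is a single node; for $j\ge1$, $T_j$ has a chain of special nodes $s_j$ (root), $s_{j-1},\dots,s_0$ with $s_i$ on level $i$ and $s_{i-1}$ the leftmost child of $s_i$, and $s_i$ ($1\le i\le j$) has $\Lambda_{j-i+1}$ children: $s_{i-1}$ followed by $\Lambda_{j-i+1}-1$ roots of copies of $T_{i-1}$. For $0\le t\le j$, $L(j,t)$ denotes the number of leaves of $T_j$ that descend from (or equal) its special node $s_t$ on level $t$. -}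

module Defs where

open import Data.Nat using (ℕ; zero; suc; _+_; _*_; _∸_)
open import Data.List using (List; []; _∷_; replicate)

data Tree : Set where
  node : List Tree → Tree

mutual
  leaves : Tree → ℕ
  leaves (node []) = 1
  leaves (node (c ∷ cs)) = leaves c + leavesList cs

  leavesList : List Tree → ℕ
  leavesList [] = 0
  leavesList (c ∷ cs) = leaves c + leavesList cs

Σ1 : (ℕ → ℕ) → ℕ → ℕ
Σ1 f zero = 0
Σ1 f (suc n) = Σ1 f n + f (suc n)

-- Sequence λ is given as a function ℕ → ℕ, indexed from 1 (value at 0 unused).
-- Λ_j = Σ_{i=1}^{j} λ_i
Λ : (ℕ → ℕ) → ℕ → ℕ
Λ lam j = Σ1 lam j

-- subtreeAt lam j i : the subtree of T_j rooted at the special node s_i (i ≤ j).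
-- s_0 is a single node; s_{i+1} has Λ_{j-i} children: s_i followed by
-- Λ_{j-i} - 1 copies of T_i.
mutual
  subtreeAt : (ℕ → ℕ) → ℕ → ℕ → Tree
  subtreeAt lam j zero = node []
  subtreeAt lam j (suc i) =
    node (subtreeAt lam j i ∷ replicate (Λ lam (j ∸ i) ∸ 1) (T lam i))

  T : (ℕ → ℕ) → ℕ → Tree
  T lam j = subtreeAt lam j j

leftmostDesc : ℕ → Tree → Tree
leftmostDesc zero t = t
leftmostDesc (suc n) (node []) = node []
leftmostDesc (suc n) (node (c ∷ cs)) = leftmostDesc n c

-- L(j,t): number of leaves of T_j descending from the special node on level t,
-- i.e. the node reached from the root by taking the leftmost child j - t times.
L : (ℕ → ℕ) → ℕ → ℕ → ℕ
L lam j t = leaves (leftmostDesc (j ∸ t) (T lam j))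

-- T_j restricted to the special node s_{t+1} consists of s_t together with
-- Λ_{j-t} - 1 copies of T_t, so L(j,t+1) = L(j,t) + (Λ_{j-t} - 1) L(t,t), with
-- L(j,0) = 1.  Shifting both indices down by i leaves j - t, and hence this
-- recurrence, unchanged; so both sides of the claimed formula satisfy the same
-- recurrence in t, and they agree at t = 1 because L(j,1) = Λ_j (this is where
-- λ_1 ≥ 1 is needed, as otherwise Λ_j - 1 truncates).
module Submission where

open import Defs
open import Data.Nat using (ℕ; _+_; _*_; _∸_; _≤_; _<_; zero; suc; s≤s; z≤n)
open import Data.Nat.Properties
open import Data.List using (replicate)
open import Data.Product using (_×_; _,_)
open import Relation.Binary.PropositionalEquality
open import Data.Nat.Tactic.RingSolver using (solve-∀)

Σ1-cong : ∀ {f g} n → (∀ i → 1 ≤ i → i ≤ n → f i ≡ g i) → Σ1 f n ≡ Σ1 g n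
Σ1-cong zero eq = refl
Σ1-cong (suc n) eq =
  cong₂ _+_ (Σ1-cong n (λ i 1≤i i≤n → eq i 1≤i (m≤n⇒m≤1+n i≤n))) (eq (suc n) (s≤s z≤n) ≤-refl)

Σ1-distrib-+ : ∀ f g n → Σ1 (λ i → f i + g i) n ≡ Σ1 f n + Σ1 g n
Σ1-distrib-+ f g zero = refl
Σ1-distrib-+ f g (suc n) rewrite Σ1-distrib-+ f g n =
  interchange (Σ1 f n) (Σ1 g n) (f (suc n)) (g (suc n))
  where
  interchange : ∀ a b c d → a + b + (c + d) ≡ a + c + (b + d)
  interchange = solve-∀

Σ1-distribˡ-* : ∀ c f n → Σ1 (λ i → c * f i) n ≡ c * Σ1 f n
Σ1-distribˡ-* c f zero = sym (*-zeroʳ c)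
Σ1-distribˡ-* c f (suc n) rewrite Σ1-distribˡ-* c f n = sym (*-distribˡ-+ c (Σ1 f n) (f (suc n)))

Σ1-suc-head : ∀ f n → Σ1 f (suc n) ≡ f 1 + Σ1 (λ i → f (suc i)) n
Σ1-suc-head f zero = +-comm 0 (f 1)
Σ1-suc-head f (suc n) rewrite Σ1-suc-head f n = +-assoc (f 1) _ _

leavesList-replicate : ∀ n x → leavesList (replicate n x) ≡ n * leaves x
leavesList-replicate zero x = refl
leavesList-replicate (suc n) x = cong (leaves x +_) (leavesList-replicate n x)

module _ (lam : ℕ → ℕ) where

  leftmostDesc-subtreeAt : ∀ n t j → leftmostDesc n (subtreeAt lam j (n + t)) ≡ subtreeAt lam j t
  leftmostDesc-subtreeAt zero t j = refl
  leftmostDesc-subtreeAt (suc n) t j = leftmostDesc-subtreeAt n t j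

  L≡leaves-subtreeAt : ∀ {j t} → t ≤ j → L lam j t ≡ leaves (subtreeAt lam j t)
  L≡leaves-subtreeAt {j} {t} t≤j = begin
    leaves (leftmostDesc (j ∸ t) (subtreeAt lam j j))
      ≡⟨ cong (λ s → leaves (leftmostDesc (j ∸ t) (subtreeAt lam j s))) (sym (m∸n+n≡m t≤j)) ⟩
    leaves (leftmostDesc (j ∸ t) (subtreeAt lam j (j ∸ t + t)))
      ≡⟨ cong leaves (leftmostDesc-subtreeAt (j ∸ t) t j) ⟩
    leaves (subtreeAt lam j t) ∎
    where open ≡-Reasoning

  L-zero : ∀ j → L lam j 0 ≡ 1
  L-zero j = L≡leaves-subtreeAt {j} {0} z≤n

  L-suc : ∀ {j t} → suc t ≤ j → L lam j (suc t) ≡ L lam j t + (Λ lam (j ∸ t) ∸ 1) * L lam t t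
  L-suc {j} {t} t<j = begin
    L lam j (suc t)
      ≡⟨ L≡leaves-subtreeAt t<j ⟩
    leaves (subtreeAt lam j t) + leavesList (replicate c (T lam t))
      ≡⟨ cong₂ _+_ (sym (L≡leaves-subtreeAt (<⇒≤ t<j))) (leavesList-replicate c (T lam t)) ⟩
    L lam j t + c * leaves (T lam t)
      ≡⟨ cong (λ x → L lam j t + c * x) (sym (L≡leaves-subtreeAt {t} ≤-refl)) ⟩
    L lam j t + c * L lam t t ∎
    where
    open ≡-Reasoning
    c = Λ lam (j ∸ t) ∸ 1

  L-suc-shifted : ∀ {i j t} → i ≤ t → suc t ≤ j →
    L lam (j ∸ i) (suc t ∸ i) ≡ L lam (j ∸ i) (t ∸ i) + (Λ lam (j ∸ t) ∸ 1) * L lam (t ∸ i) (t ∸ i)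
  L-suc-shifted {i} {j} {t} i≤t t<j = begin
    L lam (j ∸ i) (suc t ∸ i)
      ≡⟨ cong (L lam (j ∸ i)) (+-∸-assoc 1 i≤t) ⟩
    L lam (j ∸ i) (suc (t ∸ i))
      ≡⟨ L-suc (subst (_≤ j ∸ i) (+-∸-assoc 1 i≤t) (∸-monoˡ-≤ i t<j)) ⟩
    L lam (j ∸ i) (t ∸ i) + (Λ lam (j ∸ i ∸ (t ∸ i)) ∸ 1) * L lam (t ∸ i) (t ∸ i)
      ≡⟨ cong (λ d → L lam (j ∸ i) (t ∸ i) + (Λ lam d ∸ 1) * L lam (t ∸ i) (t ∸ i)) gap ⟩
    L lam (j ∸ i) (t ∸ i) + (Λ lam (j ∸ t) ∸ 1) * L lam (t ∸ i) (t ∸ i) ∎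
    where
    open ≡-Reasoning
    gap : j ∸ i ∸ (t ∸ i) ≡ j ∸ t
    gap = trans (∸-+-assoc j i (t ∸ i)) (cong (j ∸_) (m+[n∸m]≡n i≤t))

  headSum : ℕ → ℕ → ℕ
  headSum j t = Σ1 (λ i → lam i * L lam (j ∸ i) (t ∸ i)) t

  tailSum : ℕ → ℕ → ℕ
  tailSum j t = Σ1 (λ i → lam (t + i)) (j ∸ t)

  tailSum-diagonal : ∀ t → tailSum t t ≡ 0
  tailSum-diagonal t rewrite n∸n≡0 t = refl

  tailSum-suc : ∀ {j t} → suc t ≤ j → tailSum j t ≡ lam (suc t) + tailSum j (suc t)
  tailSum-suc {j} {t} t<j = begin
    Σ1 (λ i → lam (t + i)) (j ∸ t)
      ≡⟨ cong (Σ1 (λ i → lam (t + i))) (+-∸-assoc 1 t<j) ⟩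
    Σ1 (λ i → lam (t + i)) (suc (j ∸ suc t))
      ≡⟨ Σ1-suc-head (λ i → lam (t + i)) (j ∸ suc t) ⟩
    lam (t + 1) + Σ1 (λ i → lam (t + suc i)) (j ∸ suc t)
      ≡⟨ cong₂ (λ a b → lam a + b) (+-comm t 1) (Σ1-cong (j ∸ suc t) (λ i _ _ → cong lam (+-suc t i))) ⟩
    lam (suc t) + Σ1 (λ i → lam (suc t + i)) (j ∸ suc t) ∎
    where open ≡-Reasoning

  headSum-suc : ∀ {j t} → suc t ≤ j →
    headSum j (suc t) ≡ headSum j t + (Λ lam (j ∸ t) ∸ 1) * headSum t t + lam (suc t)
  headSum-suc {j} {t} t<j = begin
    Σ1 (λ i → lam i * L lam (j ∸ i) (suc t ∸ i)) t + lam (suc t) * L lam (j ∸ suc t) (t ∸ t)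
      ≡⟨ cong₂ _+_ (Σ1-cong t (λ i _ i≤t → shifted i i≤t)) newTerm ⟩
    Σ1 (λ i → lam i * L lam (j ∸ i) (t ∸ i) + c * (lam i * L lam (t ∸ i) (t ∸ i))) t + lam (suc t)
      ≡⟨ cong (_+ lam (suc t)) (trans (Σ1-distrib-+ _ _ t) (cong (headSum j t +_) (Σ1-distribˡ-* c _ t))) ⟩
    headSum j t + c * headSum t t + lam (suc t) ∎
    where
    open ≡-Reasoning
    c = Λ lam (j ∸ t) ∸ 1
    newTerm : lam (suc t) * L lam (j ∸ suc t) (t ∸ t) ≡ lam (suc t)
    newTerm rewrite n∸n≡0 t | L-zero (j ∸ suc t) = *-identityʳ (lam (suc t))
    shifted : ∀ i → i ≤ t →
      lam i * L lam (j ∸ i) (suc t ∸ i) ≡ lam i * L lam (j ∸ i) (t ∸ i) + c * (lam i * L lam (t ∸ i) (t ∸ i))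
    shifted i i≤t rewrite L-suc-shifted i≤t t<j =
      distrib (lam i) (L lam (j ∸ i) (t ∸ i)) c (L lam (t ∸ i) (t ∸ i))
      where
      distrib : ∀ l a c b → l * (a + c * b) ≡ l * a + c * (l * b)
      distrib = solve-∀

  Λ-positive : 1 ≤ lam 1 → ∀ {j} → 1 ≤ j → 1 ≤ Λ lam j
  Λ-positive 1≤λ₁ {suc j} _ = ≤-trans 1≤λ₁ (≤-trans (m≤m+n (lam 1) _) (≤-reflexive (sym (Σ1-suc-head lam j))))

  L-one : 1 ≤ lam 1 → ∀ {j} → 1 ≤ j → L lam j 1 ≡ Λ lam j
  L-one 1≤λ₁ {j} 1≤j = begin
    L lam j 1                       ≡⟨ L-suc 1≤j ⟩
    L lam j 0 + (Λ lam j ∸ 1) * L lam 0 0 ≡⟨ cong₂ (λ a b → a + (Λ lam j ∸ 1) * b) (L-zero j) (L-zero 0) ⟩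
    1 + (Λ lam j ∸ 1) * 1           ≡⟨ cong (1 +_) (*-identityʳ (Λ lam j ∸ 1)) ⟩
    1 + (Λ lam j ∸ 1)               ≡⟨ m+[n∸m]≡n (Λ-positive 1≤λ₁ 1≤j) ⟩
    Λ lam j ∎
    where open ≡-Reasoning

  L-formula : 1 ≤ lam 1 → ∀ t j → suc t ≤ j → L lam j (suc t) ≡ headSum j (suc t) + tailSum j (suc t)
  L-formula 1≤λ₁ zero j 1≤j = begin
    L lam j 1                             ≡⟨ L-one 1≤λ₁ 1≤j ⟩
    tailSum j 0                           ≡⟨ tailSum-suc 1≤j ⟩
    lam 1 + tailSum j 1                   ≡⟨ cong (_+ tailSum j 1) (sym headSum-one) ⟩
    headSum j 1 + tailSum j 1 ∎
    where
    open ≡-Reasoning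
    headSum-one : headSum j 1 ≡ lam 1
    headSum-one = trans (headSum-suc 1≤j) (cong (_+ lam 1) (*-zeroʳ (Λ lam j ∸ 1)))
  L-formula 1≤λ₁ (suc s) j t<j = begin
    L lam j (suc t)
      ≡⟨ L-suc t<j ⟩
    L lam j t + c * L lam t t
      ≡⟨ cong₂ (λ a b → a + c * b) (L-formula 1≤λ₁ s j (<⇒≤ t<j)) (L-formula 1≤λ₁ s t ≤-refl) ⟩
    (headSum j t + tailSum j t) + c * (headSum t t + tailSum t t)
      ≡⟨ cong₂ (λ a b → (headSum j t + a) + c * (headSum t t + b)) (tailSum-suc t<j) (tailSum-diagonal t) ⟩
    (headSum j t + (lam (suc t) + tailSum j (suc t))) + c * (headSum t t + 0)
      ≡⟨ regroup (headSum j t) (lam (suc t)) (tailSum j (suc t)) c (headSum t t) ⟩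
    (headSum j t + c * headSum t t + lam (suc t)) + tailSum j (suc t)
      ≡⟨ cong (_+ tailSum j (suc t)) (sym (headSum-suc t<j)) ⟩
    headSum j (suc t) + tailSum j (suc t) ∎
    where
    open ≡-Reasoning
    t = suc s
    c = Λ lam (j ∸ t) ∸ 1
    regroup : ∀ h l r c g → (h + (l + r)) + c * (g + 0) ≡ (h + c * g + l) + r
    regroup = solve-∀

proposition4p15 : (lam : ℕ → ℕ) (k : ℕ) → 1 ≤ k → 1 ≤ lam 1 → 1 ≤ lam k
    → (∀ i → k < i → lam i ≡ 0) → (k ≡ 1 → 2 ≤ lam 1)
    → ((j : ℕ) → L lam j 0 ≡ 1)
      × ((j t : ℕ) → 1 ≤ t → t ≤ j
         → L lam j t ≡ Σ1 (λ i → lam i * L lam (j ∸ i) (t ∸ i)) t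
                       + Σ1 (λ i → lam (t + i)) (j ∸ t))
proposition4p15 lam k _ 1≤λ₁ _ _ _ =
  L-zero lam , λ { j (suc s) _ t≤j → L-formula lam 1≤λ₁ s j t≤j }
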